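{- Let $S$ be a numerical semigroup with elements $\lambda_0=0<\lambda_1<\lambda_2<\cdots$. The set $L$ of non-zero elements $\lambda_i\in S$ such that $G(i)=0$ is an ideal of $S$.
   Context: A numerical semigroup $S$ is a subset of $\mathbb{N}_0$ containing $0$, closed under addition, with finite complement. Gaps of $S$ are the elements of $\mathbb{N}_0\setminus S$. For $i\ge0$, $G(i)$ denotes the number of pairs of gaps adding up to $\lambda_i$. An ideal of $S$ is a subset $I\subseteq S$ with $I+S\subseteq I$. -}

module Defs where

open import Data.Nat using (ℕ; zero; suc; _+_; _∸_; _≤_; _<_)
open import Data.Bool using (Bool; true; false; not; _∧_)
open import Data.List using (List; length; filterᵇ; upTo)
open import Data.Product using (Σ; ∃; _×_; _,_)
open import Relation.Binary.PropositionalEquality using (_≡_; _≢_)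

record NumericalSemigroup : Set where
  field
    mem      : ℕ → Bool
    zero∈    : mem 0 ≡ true
    closed   : ∀ a b → mem a ≡ true → mem b ≡ true → mem (a + b) ≡ true
    cofinite : ∃ λ c → ∀ n → c ≤ n → mem n ≡ true

  isGap : ℕ → Bool
  isGap n = not (mem n)

open NumericalSemigroup public

record IsEnumeration (S : NumericalSemigroup) (λ' : ℕ → ℕ) : Set where
  field
    strictMono : ∀ i → λ' i < λ' (suc i)
    inS        : ∀ i → mem S (λ' i) ≡ true
    onto       : ∀ s → mem S s ≡ true → ∃ λ i → λ' i ≡ s

gapPairs : NumericalSemigroup → ℕ → ℕ
gapPairs S n = length (filterᵇ (λ x → isGap S x ∧ isGap S (n ∸ x)) (upTo (suc n)))

G : (S : NumericalSemigroup) → (ℕ → ℕ) → ℕ → ℕ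
G S λ' i = gapPairs S (λ' i)

L : (S : NumericalSemigroup) → (ℕ → ℕ) → ℕ → Set
L S λ' x = ∃ λ i → λ' i ≡ x × x ≢ 0 × G S λ' i ≡ 0

IsIdeal : (S : NumericalSemigroup) → (ℕ → Set) → Set
IsIdeal S I = (∀ x → I x → mem S x ≡ true)
            × (∀ x s → I x → mem S s ≡ true → I (x + s))

-- Call x "not a sum of gaps" (G = 0) if x − g ∈ S for every gap g ≤ x.
-- A nonzero such x ∈ S exceeds every gap: otherwise let d + x be the least gap
-- ≥ x. For every gap g < x, d + g is again a gap, since
-- (d + g) + (x − g) = d + x, and it lies below d + x, hence below x.
-- As d itself is such a gap, every multiple of d would be a gap below x.
-- So for s ∈ S and any gap g ≤ x + s we have g < x, and
-- (x + s) − g = (x − g) + s ∈ S: x + s is not a sum of gaps either.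
module Submission where

open import Defs
open import Data.Nat using (ℕ; zero; suc; _+_; _*_; _∸_; _≤_; _<_; s≤s; ≢-nonZero)
open import Data.Nat.Properties
open import Data.Nat.Induction using (<-rec)
open import Data.Bool using (Bool; true; false; not; _∧_; T)
open import Data.Bool.Properties using (T?)
open import Data.Unit using (tt)
open import Data.List using (length)
open import Data.List.Properties using (filter-some; filter-none)
open import Data.List.Relation.Unary.All as All using ()
open import Data.List.Relation.Unary.All.Properties using (all-upTo)
open import Data.List.Membership.Propositional using (lose)
open import Data.List.Membership.Propositional.Properties using (∈-upTo⁺)
open import Data.Product using (_×_; _,_; proj₂)
open import Data.Empty using (⊥; ⊥-elim)
open import Function using (_∘_)
open import Relation.Nullary using (yes; no; ¬_; contradiction)
open import Relation.Binary.PropositionalEquality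

module _ (S : NumericalSemigroup) where

  NotSumOfGaps : ℕ → Set
  NotSumOfGaps n = ∀ g → g ≤ n → mem S g ≡ false → mem S (n ∸ g) ≡ true

  gapPair : ℕ → ℕ → Bool
  gapPair n y = isGap S y ∧ isGap S (n ∸ y)

  ∈S⇒¬gap : ∀ {a} → mem S a ≡ true → mem S a ≢ false
  ∈S⇒¬gap a∈S a∉S with () ← trans (sym a∈S) a∉S

  gapPairs≡0⇒notSumOfGaps : ∀ n → gapPairs S n ≡ 0 → NotSumOfGaps n
  gapPairs≡0⇒notSumOfGaps n none g g≤n g∉S with mem S (n ∸ g) in n∸g∉S
  ... | true  = refl
  ... | false = contradiction none (>⇒≢ (filter-some (T? ∘ gapPair n) g-counted))
    where
      g-counted = lose (∈-upTo⁺ (s≤s g≤n))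
                       (subst T (sym (cong₂ _∧_ (cong not g∉S) (cong not n∸g∉S))) tt)

  gapPair≡false : ∀ {n y} → (mem S y ≡ false → mem S (n ∸ y) ≡ true) → gapPair n y ≡ false
  gapPair≡false {y = y} complement with mem S y
  ... | true  = refl
  ... | false rewrite complement refl = refl

  notSumOfGaps⇒gapPairs≡0 : ∀ n → NotSumOfGaps n → gapPairs S n ≡ 0
  notSumOfGaps⇒gapPairs≡0 n split =
    cong length (filter-none (T? ∘ gapPair n) (All.map rejected (all-upTo (suc n))))
    where
      rejected : ∀ {y} → y < suc n → ¬ T (gapPair n y)
      rejected y<1+n = subst T (gapPair≡false (split _ (≤-pred y<1+n)))

  shift-gap : ∀ {x d g} → mem S (d + x) ≡ false → NotSumOfGaps x →
              g ≤ x → mem S g ≡ false → mem S (d + g) ≡ false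
  shift-gap {x} {d} {g} d+x∉S split g≤x g∉S with mem S (d + g) in d+g∈S
  ... | false = refl
  ... | true  = contradiction d+x∉S (∈S⇒¬gap (subst (λ t → mem S t ≡ true) sum-eq
                  (closed S _ _ d+g∈S (split g g≤x g∉S))))
    where
      sum-eq : d + g + (x ∸ g) ≡ d + x
      sum-eq = trans (+-assoc d g (x ∸ g)) (cong (d +_) (m+[n∸m]≡n g≤x))

  module _ {x} (x∈S : mem S x ≡ true) (x≢0 : x ≢ 0) (split : NotSumOfGaps x) where

    no-least-gap-above : ∀ d → mem S (d + x) ≡ false →
                         (∀ {b} → b < d + x → mem S b ≡ false → b < x) → ⊥
    no-least-gap-above d d+x∉S below =
      <⇒≱ (proj₂ (multiples x)) (≤-trans (n≤1+n x) suc[x]≤suc[x]*d)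
      where
        d∉S : mem S d ≡ false
        d∉S with mem S d in d∈S
        ... | false = refl
        ... | true  = contradiction d+x∉S (∈S⇒¬gap (closed S d x d∈S x∈S))

        d≢0 : d ≢ 0
        d≢0 refl = ∈S⇒¬gap x∈S d+x∉S

        suc[x]≤suc[x]*d : suc x ≤ suc x * d
        suc[x]≤suc[x]*d = m≤m*n (suc x) d ⦃ ≢-nonZero d≢0 ⦄

        multiples : ∀ k → mem S (suc k * d) ≡ false × suc k * d < x
        multiples zero rewrite *-identityˡ d = d∉S , below (m<m+n d (n≢0⇒n>0 x≢0)) d∉S
        multiples (suc k) with g∉S , g<x ← multiples k =
          d+g∉S , below (+-monoʳ-< d g<x) d+g∉S
          where d+g∉S = shift-gap d+x∉S split (<⇒≤ g<x) g∉S

    gap<x : ∀ a → mem S a ≡ false → a < x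
    gap<x = <-rec (λ a → mem S a ≡ false → a < x) step
      where
        step : ∀ a → (∀ {b} → b < a → mem S b ≡ false → b < x) → mem S a ≡ false → a < x
        step a below a∉S with a <? x
        ... | yes a<x = a<x
        ... | no  a≮x = ⊥-elim (no-least-gap-above (a ∸ x) d+x∉S (below ∘ subst (_ <_) d+x≡a))
          where
            d+x≡a = m∸n+n≡m (≮⇒≥ a≮x)
            d+x∉S = subst (λ t → mem S t ≡ false) (sym d+x≡a) a∉S

    notSumOfGaps-+ : ∀ s → mem S s ≡ true → NotSumOfGaps (x + s)
    notSumOfGaps-+ s s∈S g _ g∉S = subst (λ t → mem S t ≡ true) (sym (+-∸-comm s g≤x))
                                     (closed S _ _ (split g g≤x g∉S) s∈S)
      where g≤x = <⇒≤ (gap<x g g∉S)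

lemma4 : (S : NumericalSemigroup) (λ' : ℕ → ℕ) → IsEnumeration S λ' → IsIdeal S (L S λ')
lemma4 S λ' E = L⊆S , L+S⊆L
  where
    open IsEnumeration E
    L⊆S : ∀ x → L S λ' x → mem S x ≡ true
    L⊆S x (i , refl , _) = inS i

    L+S⊆L : ∀ x s → L S λ' x → mem S s ≡ true → L S λ' (x + s)
    L+S⊆L x s (i , refl , x≢0 , G≡0) s∈S with j , λj≡x+s ← onto (x + s) (closed S x s (inS i) s∈S) =
      j , λj≡x+s , (x≢0 ∘ m+n≡0⇒m≡0 x) ,
      subst (λ t → gapPairs S t ≡ 0) (sym λj≡x+s)
        (notSumOfGaps⇒gapPairs≡0 S (x + s)
          (notSumOfGaps-+ S (inS i) x≢0 (gapPairs≡0⇒notSumOfGaps S x G≡0) s s∈S))
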